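{- Let $n \ge 1$, let $\pi$ be a permutation of $\{1, \ldots, n^2\}$, let $x \in \mathbb{Z}^{n^2}$ with $A_\pi x <> \mathbf{0}$ and let $y \in \mathbb{Z}^{n^2}$. If $\tau_1$ and $\tau_2$ are $\pi$-consistent permutations of $\{1, \ldots, n^2\}$ with $y = \tau_1(x)$ and $y = \tau_2(x)$, then $\tau_1 = \tau_2$.
   Context: For $y \in \mathbb{Z}^s$ write $y <> \mathbf{0}$ if every component of $y$ is nonzero. Let $s(n) = \sum_{i=1}^{n-1} i$. The $s(n) \times n$ matrix $A(n)$ is defined inductively: $A(1)$ is the empty matrix, and $A(n) = \begin{pmatrix} \mathbf{1}_{n-1} & -U_{n-1} \\ \mathbf{0}_{s(n-1)} & A(n-1) \end{pmatrix}$, where $\mathbf{1}_{n-1}$ is the all-ones column, $U_{n-1}$ the identity matrix and $\mathbf{0}_{s(n-1)}$ the zero column of length $s(n-1)$. Let $A$ be the $(n \cdot s(n)) \times n^2$ block-diagonal matrix whose $n$ diagonal blocks all equal $A(n)$. For a permutation $\pi$ of $\{1,\ldots,n^2\}$, $A_\pi$ is the matrix whose $j$-th column is the $\pi^{ -1}(j)$-th column of $A$. For a permutation $\tau$ and $x \in \mathbb{Z}^{n^2}$, $\tau(x) = (x_{\tau^{ -1}(1)}, \ldots, x_{\tau^{ -1}(n^2)})^T$. The constraint sets of $\pi$ are $cs_\pi(j) = \{\pi(i) \mid (j-1)n + 1 \le i \le jn\}$, $j=1,\ldots,n$. A permutation $\tau$ is $\pi$-consistent if $\tau(cs_\pi(j))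 = cs_\pi(j)$ for $j = 1,\ldots,n$. -}

module Defs where

open import Data.Nat using (ℕ; zero; suc) renaming (_+_ to _+ℕ_; _*_ to _*ℕ_)
open import Data.Integer using (ℤ; _+_; _*_; -_; 0ℤ; 1ℤ)
open import Data.Fin using (Fin; zero; suc; splitAt; remQuot; _≟_)
open import Data.Fin.Permutation using (Permutation′; _⟨$⟩ʳ_; _⟨$⟩ˡ_)
open import Data.Product using (Σ; _×_; proj₁; proj₂; _,_)
open import Data.Sum using (inj₁; inj₂)
open import Relation.Nullary using (¬_; yes; no)
open import Relation.Binary.PropositionalEquality using (_≡_)

-- Indices are 0-based: {1,…,N} is rendered as Fin N.

s : ℕ → ℕ
s zero    = 0
s (suc n) = n +ℕ s n

Matrix : ℕ → ℕ → Set
Matrix m k = Fin m → Fin k → ℤ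

Vector : ℕ → Set
Vector m = Fin m → ℤ

δ : ∀ {n} → Fin n → Fin n → ℤ
δ i j with i ≟ j
... | yes _ = 1ℤ
... | no  _ = 0ℤ

-- A(n) as an s(n) × n matrix, defined inductively:
-- A(n+1) = ( 1_n   -U_n
--            0     A(n) ),  A(1) empty (A(0) only used vacuously).
A-n : (n : ℕ) → Matrix (s n) n
A-n (suc n) r c with splitAt n r
A-n (suc n) r zero    | inj₁ i  = 1ℤ
A-n (suc n) r (suc j) | inj₁ i  = - δ i j
A-n (suc n) r zero    | inj₂ r′ = 0ℤ
A-n (suc n) r (suc j) | inj₂ r′ = A-n n r′ j

-- A: (n·s(n)) × n² block diagonal with n diagonal blocks A(n).
-- Row index ↦ (block, row in block), column index ↦ (block, column in block).
A : (n : ℕ) → Matrix (n *ℕ s n) (n *ℕ n)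
A n r c with remQuot {n} (s n) r | remQuot {n} n c
... | (b , i) | (b′ , j) with b ≟ b′
...   | yes _ = A-n n i j
...   | no  _ = 0ℤ

A-π : (n : ℕ) → Permutation′ (n *ℕ n) → Matrix (n *ℕ s n) (n *ℕ n)
A-π n π r j = A n r (π ⟨$⟩ˡ j)

sumℤ : ∀ {m} → (Fin m → ℤ) → ℤ
sumℤ {zero}  f = 0ℤ
sumℤ {suc m} f = f zero + sumℤ (λ i → f (suc i))

_·_ : ∀ {m k} → Matrix m k → Vector k → Vector m
(M · x) r = sumℤ (λ j → M r j * x j)

_<>0 : ∀ {m} → Vector m → Set
y <>0 = ∀ r → ¬ (y r ≡ 0ℤ)

permVec : ∀ {m} → Permutation′ m → Vector m → Vector m
permVec τ x k = x (τ ⟨$⟩ˡ k)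

-- constraint sets: k ∈ cs_π(j) iff k = π(i) for some i in the j-th block
-- of n consecutive indices (i.e. quotient of i by n is j).
_∈cs[_,_] : ∀ {n} → Fin (n *ℕ n) → Permutation′ (n *ℕ n) → Fin n → Set
_∈cs[_,_] {n} k π j = Σ (Fin (n *ℕ n)) λ i → proj₁ (remQuot {n} n i) ≡ j × π ⟨$⟩ʳ i ≡ k

-- τ is π-consistent: τ(cs_π(j)) = cs_π(j) as sets, for every j
consistent : (n : ℕ) → Permutation′ (n *ℕ n) → Permutation′ (n *ℕ n) → Set
consistent n π τ = ∀ (j : Fin n) →
  (∀ k → k ∈cs[ π , j ] → (τ ⟨$⟩ʳ k) ∈cs[ π , j ]) ×
  (∀ k → k ∈cs[ π , j ] → Σ (Fin (n *ℕ n)) λ k′ → k′ ∈cs[ π , j ] × τ ⟨$⟩ʳ k′ ≡ k)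

module Submission where

-- Call a row vector a *difference row* for columns (p, q) if it
-- equals e_p − e_q.  For any two distinct columns p ≠ q of A(n), some row of
-- A(n) is a difference row for (p, q) or (q, p); by the block-diagonal shape
-- the same holds inside each diagonal block of A, and permuting columns by π
-- carries it to A_π.  A difference row for (c₁, c₂) evaluates to x c₁ − x c₂,
-- so A_π x <> 0 forces x to be injective on every constraint set cs_π(b).
-- Finally, a π-consistent τ maps every constraint set onto itself, so if
-- τ₁(x) = τ₂(x) then τ₁ i and τ₂ i both come from points of the constraint set
-- of i carrying the same x-value, hence coincide.

open import Defs
open import Data.Nat using (ℕ; _≥_; zero; suc) renaming (_*_ to _*ℕ_)
open import Data.Integer using (ℤ; _+_; _*_; -_; 0ℤ; 1ℤ; -1ℤ)
open import Data.Integer.Properties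
  using (+-comm; +-identityˡ; +-identityʳ; *-identityˡ; -1*i≡-i; +-inverseʳ)
open import Data.Fin using (Fin; zero; suc; remQuot; combine; _≟_; _↑ˡ_; _↑ʳ_)
open import Data.Fin.Properties
  using (splitAt-↑ˡ; splitAt-↑ʳ; remQuot-combine; combine-remQuot; suc-injective)
open import Data.Fin.Permutation using (Permutation′; _⟨$⟩ʳ_; _⟨$⟩ˡ_; inverseˡ; inverseʳ)
open import Data.Product using (Σ; _×_; proj₁; proj₂; _,_; uncurry)
open import Data.Sum using (_⊎_; inj₁; inj₂)
open import Data.Empty using (⊥-elim)
open import Relation.Nullary using (yes; no)
open import Relation.Binary.PropositionalEquality
  using (_≡_; refl; sym; trans; cong; cong₂; subst; _≢_)
open Relation.Binary.PropositionalEquality.≡-Reasoning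

sumℤ-zero : ∀ {m} (f : Fin m → ℤ) → (∀ c → f c ≡ 0ℤ) → sumℤ f ≡ 0ℤ
sumℤ-zero {zero}  f h = refl
sumℤ-zero {suc m} f h
  rewrite h zero | sumℤ-zero (λ i → f (suc i)) (λ c → h (suc c)) = refl

sumℤ-single : ∀ {m} (f : Fin m → ℤ) j → (∀ c → c ≢ j → f c ≡ 0ℤ) → sumℤ f ≡ f j
sumℤ-single {suc m} f zero h
  rewrite sumℤ-zero (λ i → f (suc i)) (λ c → h (suc c) (λ ())) = +-identityʳ (f zero)
sumℤ-single {suc m} f (suc j) h
  rewrite h zero (λ ())
        | sumℤ-single (λ i → f (suc i)) j (λ c c≢j → h (suc c) (λ e → c≢j (suc-injective e)))
  = +-identityˡ (f (suc j))

sumℤ-pair : ∀ {m} (f : Fin m → ℤ) j₁ j₂ → j₁ ≢ j₂ →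
            (∀ c → c ≢ j₁ → c ≢ j₂ → f c ≡ 0ℤ) → sumℤ f ≡ f j₁ + f j₂
sumℤ-pair {suc m} f zero zero j₁≢j₂ h = ⊥-elim (j₁≢j₂ refl)
sumℤ-pair {suc m} f zero (suc k) j₁≢j₂ h =
  cong (f zero +_) (sumℤ-single (λ i → f (suc i)) k
    (λ c c≢k → h (suc c) (λ ()) (λ e → c≢k (suc-injective e))))
sumℤ-pair {suc m} f (suc k) zero j₁≢j₂ h = begin
  f zero + sumℤ (λ i → f (suc i)) ≡⟨ cong (f zero +_) (sumℤ-single (λ i → f (suc i)) k
                                       (λ c c≢k → h (suc c) (λ e → c≢k (suc-injective e)) (λ ()))) ⟩
  f zero + f (suc k)              ≡⟨ +-comm (f zero) (f (suc k)) ⟩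
  f (suc k) + f zero              ∎
sumℤ-pair {suc m} f (suc k) (suc l) j₁≢j₂ h
  rewrite h zero (λ ()) (λ ()) =
  trans (+-identityˡ _)
    (sumℤ-pair (λ i → f (suc i)) k l (λ e → j₁≢j₂ (cong suc e))
      (λ c c≢k c≢l → h (suc c) (λ e → c≢k (suc-injective e)) (λ e → c≢l (suc-injective e))))

DiffRow : ∀ {k} → (Fin k → ℤ) → Fin k → Fin k → Set
DiffRow f p q = (f p ≡ 1ℤ) × (f q ≡ -1ℤ) × (∀ c → c ≢ p → c ≢ q → f c ≡ 0ℤ)

diffRow-distinct : ∀ {k} {f : Fin k → ℤ} {p q} → DiffRow f p q → p ≢ q
diffRow-distinct (fp≡1 , fq≡-1 , _) refl with trans (sym fp≡1) fq≡-1
... | ()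

diffRow-dot : ∀ {k} (f : Fin k → ℤ) p q (x : Vector k) → DiffRow f p q →
              sumℤ (λ j → f j * x j) ≡ x p + - x q
diffRow-dot f p q x row@(fp≡1 , fq≡-1 , f≡0) =
  trans (sumℤ-pair (λ j → f j * x j) p q (diffRow-distinct row)
          (λ c c≢p c≢q → cong (_* x c) (f≡0 c c≢p c≢q)))
        (cong₂ _+_ (trans (cong (_* x p) fp≡1) (*-identityˡ (x p)))
                   (trans (cong (_* x q) fq≡-1) (-1*i≡-i (x q))))

diffRow-permute : ∀ {k} (σ : Permutation′ k) {f : Fin k → ℤ} {p q} → DiffRow f p q →
                  DiffRow (λ j → f (σ ⟨$⟩ˡ j)) (σ ⟨$⟩ʳ p) (σ ⟨$⟩ʳ q)
diffRow-permute σ {f} (fp≡1 , fq≡-1 , f≡0) =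
  trans (cong f (inverseˡ σ)) fp≡1 ,
  trans (cong f (inverseˡ σ)) fq≡-1 ,
  λ c c≢σp c≢σq → f≡0 (σ ⟨$⟩ˡ c) (away c≢σp) (away c≢σq)
  where
  away : ∀ {c p} → c ≢ σ ⟨$⟩ʳ p → σ ⟨$⟩ˡ c ≢ p
  away c≢σp e = c≢σp (trans (sym (inverseʳ σ)) (cong (σ ⟨$⟩ʳ_) e))

Separates : ∀ {m k} → Matrix m k → Fin k → Fin k → Set
Separates {m} M c₁ c₂ = Σ (Fin m) λ r → DiffRow (M r) c₁ c₂ ⊎ DiffRow (M r) c₂ c₁

separates-permute : ∀ {m k} (σ : Permutation′ k) {M : Matrix m k} {c₁ c₂} → Separates M c₁ c₂ →
                    Separates (λ r j → M r (σ ⟨$⟩ˡ j)) (σ ⟨$⟩ʳ c₁) (σ ⟨$⟩ʳ c₂)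
separates-permute σ (r , inj₁ row) = r , inj₁ (diffRow-permute σ row)
separates-permute σ (r , inj₂ row) = r , inj₂ (diffRow-permute σ row)

separates-distinct : ∀ {m k} {M : Matrix m k} (x : Vector k) → (M · x) <>0 →
                     ∀ {c₁ c₂} → Separates M c₁ c₂ → x c₁ ≢ x c₂
separates-distinct {M = M} x Mx<>0 {c₁} {c₂} (r , inj₁ row) x₁≡x₂ =
  Mx<>0 r (trans (diffRow-dot (M r) c₁ c₂ x row)
                 (trans (cong (_+ - x c₂) x₁≡x₂) (+-inverseʳ (x c₂))))
separates-distinct {M = M} x Mx<>0 {c₁} {c₂} (r , inj₂ row) x₁≡x₂ =
  Mx<>0 r (trans (diffRow-dot (M r) c₂ c₁ x row)
                 (trans (cong (_+ - x c₁) (sym x₁≡x₂)) (+-inverseʳ (x c₁))))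

δ-diag : ∀ {n} (i : Fin n) → δ i i ≡ 1ℤ
δ-diag i with i ≟ i
... | yes _   = refl
... | no i≢i  = ⊥-elim (i≢i refl)

δ-off : ∀ {n} (i j : Fin n) → i ≢ j → δ i j ≡ 0ℤ
δ-off i j i≢j with i ≟ j
... | yes i≡j = ⊥-elim (i≢j i≡j)
... | no _    = refl

top-row : ∀ {m} → Fin m → Fin (suc m) → ℤ
top-row j zero    = 1ℤ
top-row j (suc c) = - δ j c

lower-row : ∀ {m} → (Fin m → ℤ) → Fin (suc m) → ℤ
lower-row g zero    = 0ℤ
lower-row g (suc c) = g c

A-n-top : ∀ m (j : Fin m) c → A-n (suc m) (j ↑ˡ s m) c ≡ top-row j c
A-n-top m j zero    rewrite splitAt-↑ˡ m j (s m) = refl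
A-n-top m j (suc c) rewrite splitAt-↑ˡ m j (s m) = refl

A-n-lower : ∀ m (r : Fin (s m)) c → A-n (suc m) (m ↑ʳ r) c ≡ lower-row (A-n m r) c
A-n-lower m r zero    rewrite splitAt-↑ʳ m (s m) r = refl
A-n-lower m r (suc c) rewrite splitAt-↑ʳ m (s m) r = refl

top-row-diff : ∀ m (j : Fin m) → DiffRow (A-n (suc m) (j ↑ˡ s m)) zero (suc j)
top-row-diff m j =
  A-n-top m j zero ,
  trans (A-n-top m j (suc j)) (cong -_ (δ-diag j)) ,
  λ { zero    c≢0 _      → ⊥-elim (c≢0 refl)
    ; (suc c) _   c≢j+1  → trans (A-n-top m j (suc c))
                                 (cong -_ (δ-off j c (λ e → c≢j+1 (cong suc (sym e))))) }

lower-row-diff : ∀ m (r : Fin (s m)) {p q} → DiffRow (A-n m r) p q →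
                 DiffRow (A-n (suc m) (m ↑ʳ r)) (suc p) (suc q)
lower-row-diff m r {p} {q} (rp≡1 , rq≡-1 , r≡0) =
  trans (A-n-lower m r (suc p)) rp≡1 ,
  trans (A-n-lower m r (suc q)) rq≡-1 ,
  λ { zero    _ _ → A-n-lower m r zero
    ; (suc c) c≢p c≢q → trans (A-n-lower m r (suc c))
                              (r≡0 c (λ e → c≢p (cong suc e)) (λ e → c≢q (cong suc e))) }

A-n-separates : ∀ n (p q : Fin n) → p ≢ q → Separates (A-n n) p q
A-n-separates (suc m) zero    zero    p≢q = ⊥-elim (p≢q refl)
A-n-separates (suc m) zero    (suc j) p≢q = j ↑ˡ s m , inj₁ (top-row-diff m j)
A-n-separates (suc m) (suc j) zero    p≢q = j ↑ˡ s m , inj₂ (top-row-diff m j)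
A-n-separates (suc m) (suc p) (suc q) p≢q
  with A-n-separates m p q (λ e → p≢q (cong suc e))
... | r , inj₁ row = m ↑ʳ r , inj₁ (lower-row-diff m r row)
... | r , inj₂ row = m ↑ʳ r , inj₂ (lower-row-diff m r row)

A-diagonal-block : ∀ n (b : Fin n) i j → A n (combine b i) (combine b j) ≡ A-n n i j
A-diagonal-block n b i j
  rewrite cong proj₁ (remQuot-combine {n} {s n} b i) | cong proj₂ (remQuot-combine {n} {s n} b i)
        | cong proj₁ (remQuot-combine {n} {n} b j)   | cong proj₂ (remQuot-combine {n} {n} b j)
  with b ≟ b
... | yes _   = refl
... | no b≢b  = ⊥-elim (b≢b refl)

A-off-block : ∀ n {b b′ : Fin n} i j → b ≢ b′ → A n (combine b i) (combine b′ j) ≡ 0ℤ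
A-off-block n {b} {b′} i j b≢b′
  rewrite cong proj₁ (remQuot-combine {n} {s n} b i) | cong proj₂ (remQuot-combine {n} {s n} b i)
        | cong proj₁ (remQuot-combine {n} {n} b′ j)  | cong proj₂ (remQuot-combine {n} {n} b′ j)
  with b ≟ b′
... | yes b≡b′ = ⊥-elim (b≢b′ b≡b′)
... | no _     = refl

by-blocks : ∀ {n k} {P : Fin (n *ℕ k) → Set} → (∀ b j → P (combine b j)) → ∀ c → P c
by-blocks {n} {k} {P} h c = subst P (combine-remQuot {n} k c) (uncurry h (remQuot {n} k c))

A-block-diff : ∀ n (b : Fin n) (i : Fin (s n)) {p q} → DiffRow (A-n n i) p q →
               DiffRow (A n (combine b i)) (combine b p) (combine b q)
A-block-diff n b i {p} {q} (ip≡1 , iq≡-1 , i≡0) =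
  trans (A-diagonal-block n b i p) ip≡1 ,
  trans (A-diagonal-block n b i q) iq≡-1 ,
  by-blocks vanish
  where
  vanish : ∀ b′ j → combine b′ j ≢ combine b p → combine b′ j ≢ combine b q →
           A n (combine b i) (combine b′ j) ≡ 0ℤ
  vanish b′ j c≢p c≢q with b ≟ b′
  ... | yes refl = trans (A-diagonal-block n b i j)
                         (i≡0 j (λ e → c≢p (cong (combine b) e)) (λ e → c≢q (cong (combine b) e)))
  ... | no b≢b′  = A-off-block n i j b≢b′

A-separates : ∀ n (b : Fin n) (p q : Fin n) → p ≢ q → Separates (A n) (combine b p) (combine b q)
A-separates n b p q p≢q with A-n-separates n p q p≢q
... | i , inj₁ row = combine b i , inj₁ (A-block-diff n b i row)
... | i , inj₂ row = combine b i , inj₂ (A-block-diff n b i row)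

cs-member : ∀ n (π : Permutation′ (n *ℕ n)) {b : Fin n} {k} → k ∈cs[ π , b ] →
            Σ (Fin n) λ p → k ≡ π ⟨$⟩ʳ combine b p
cs-member n π (i , refl , refl) =
  proj₂ (remQuot {n} n i) , cong (π ⟨$⟩ʳ_) (sym (combine-remQuot {n} n i))

cs-own : ∀ {n} (π : Permutation′ (n *ℕ n)) k → k ∈cs[ π , proj₁ (remQuot {n} n (π ⟨$⟩ˡ k)) ]
cs-own π k = π ⟨$⟩ˡ k , refl , inverseʳ π

x-injective-on-block : ∀ n (π : Permutation′ (n *ℕ n)) (x : Vector (n *ℕ n)) → (A-π n π · x) <>0 →
                       ∀ b p q → x (π ⟨$⟩ʳ combine b p) ≡ x (π ⟨$⟩ʳ combine b q) → p ≡ q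
x-injective-on-block n π x nonzero b p q xp≡xq with p ≟ q
... | yes p≡q = p≡q
... | no p≢q  = ⊥-elim (separates-distinct x nonzero
                          (separates-permute π (A-separates n b p q p≢q)) xp≡xq)

x-injective-on-cs : ∀ n (π : Permutation′ (n *ℕ n)) (x : Vector (n *ℕ n)) → (A-π n π · x) <>0 →
                    ∀ {b : Fin n} {k₁ k₂} → k₁ ∈cs[ π , b ] → k₂ ∈cs[ π , b ] → x k₁ ≡ x k₂ → k₁ ≡ k₂
x-injective-on-cs n π x nonzero {b} {k₁} {k₂} k₁∈ k₂∈ =
  from-block (cs-member n π k₁∈) (cs-member n π k₂∈)
  where
  from-block : Σ (Fin n) (λ p → k₁ ≡ π ⟨$⟩ʳ combine b p) → Σ (Fin n) (λ q → k₂ ≡ π ⟨$⟩ʳ combine b q) →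
               x k₁ ≡ x k₂ → k₁ ≡ k₂
  from-block (p , refl) (q , refl) xp≡xq =
    cong (λ r → π ⟨$⟩ʳ combine b r) (x-injective-on-block n π x nonzero b p q xp≡xq)

consistent-agree : ∀ n (π : Permutation′ (n *ℕ n)) (x : Vector (n *ℕ n)) →
                   (∀ {b : Fin n} {k₁ k₂} → k₁ ∈cs[ π , b ] → k₂ ∈cs[ π , b ] → x k₁ ≡ x k₂ → k₁ ≡ k₂) →
                   (τ₁ τ₂ : Permutation′ (n *ℕ n)) → consistent n π τ₁ → consistent n π τ₂ →
                   (∀ k → permVec τ₁ x k ≡ permVec τ₂ x k) →
                   ∀ i → τ₁ ⟨$⟩ʳ i ≡ τ₂ ⟨$⟩ʳ i
consistent-agree n π x x-inj τ₁ τ₂ cons₁ cons₂ same i = begin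
  τ₁ ⟨$⟩ʳ i  ≡⟨ sym τ₂i′≡τ₁i ⟩
  τ₂ ⟨$⟩ʳ i′ ≡⟨ cong (τ₂ ⟨$⟩ʳ_) (sym i≡i′) ⟩
  τ₂ ⟨$⟩ʳ i  ∎
  where
  b : Fin n
  b = proj₁ (remQuot {n} n (π ⟨$⟩ˡ i))
  i∈ : i ∈cs[ π , b ]
  i∈ = cs-own π i
  -- τ₁ i stays in the constraint set of i, where it has a τ₂-preimage i′.
  preimage : Σ (Fin (n *ℕ n)) λ i′ → i′ ∈cs[ π , b ] × τ₂ ⟨$⟩ʳ i′ ≡ τ₁ ⟨$⟩ʳ i
  preimage = proj₂ (cons₂ b) (τ₁ ⟨$⟩ʳ i) (proj₁ (cons₁ b) i i∈)
  i′ : Fin (n *ℕ n)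
  i′ = proj₁ preimage
  i′∈ : i′ ∈cs[ π , b ]
  i′∈ = proj₁ (proj₂ preimage)
  τ₂i′≡τ₁i : τ₂ ⟨$⟩ʳ i′ ≡ τ₁ ⟨$⟩ʳ i
  τ₂i′≡τ₁i = proj₂ (proj₂ preimage)
  xi≡xi′ : x i ≡ x i′
  xi≡xi′ = begin
    x i                               ≡⟨ cong x (sym (inverseˡ τ₁)) ⟩
    permVec τ₁ x (τ₁ ⟨$⟩ʳ i)          ≡⟨ same (τ₁ ⟨$⟩ʳ i) ⟩
    permVec τ₂ x (τ₁ ⟨$⟩ʳ i)          ≡⟨ cong (permVec τ₂ x) (sym τ₂i′≡τ₁i) ⟩
    x (τ₂ ⟨$⟩ˡ (τ₂ ⟨$⟩ʳ i′))          ≡⟨ cong x (inverseˡ τ₂) ⟩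
    x i′                              ∎
  i≡i′ : i ≡ i′
  i≡i′ = x-inj i∈ i′∈ xi≡xi′

-- The theorem (Lemma 4.5); the argument does not need n ≥ 1.
lemma4p5 : (n : ℕ) → n ≥ 1 → (π : Permutation′ (n *ℕ n)) →
    (x : Vector (n *ℕ n)) → (A-π n π · x) <>0 → (y : Vector (n *ℕ n)) →
    (τ₁ τ₂ : Permutation′ (n *ℕ n)) → consistent n π τ₁ → consistent n π τ₂ →
    (∀ k → y k ≡ permVec τ₁ x k) → (∀ k → y k ≡ permVec τ₂ x k) →
    ∀ i → τ₁ ⟨$⟩ʳ i ≡ τ₂ ⟨$⟩ʳ i
lemma4p5 n _ π x nonzero y τ₁ τ₂ cons₁ cons₂ y≡τ₁x y≡τ₂x =
  consistent-agree n π x (x-injective-on-cs n π x nonzero) τ₁ τ₂ cons₁ cons₂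
    (λ k → trans (sym (y≡τ₁x k)) (y≡τ₂x k))
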